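{- Let $G$ be a graph obtained from a cubic graph by subdividing exactly one edge twice and each of the remaining edges once, and let $e_1,e_2$ be the two non-adjacent edges among the three edges obtained by subdividing that single edge twice. For every $k\ge 3$, if $G$ is $k$-edge-colorable, then $G$ has proper $k$-edge colorings $c_1$ and $c_2$ such that $c_1(e_1)=c_1(e_2)$ and $c_2(e_1)\neq c_2(e_2)$.
   Context: A proper $k$-edge coloring of $G$ is a map $E(G)\to\{1,\dots,k\}$ giving distinct colors to any two edges sharing an endpoint; $G$ is $k$-edge-colorable if one exists. -}

module Defs where

open import Data.Nat using (ℕ; zero; suc; _+_)
open import Data.Fin using (Fin; _↑ˡ_; _↑ʳ_; splitAt; _≟_)
open import Data.Product using (_×_; _,_; proj₁; proj₂; Σ-syntax)
open import Data.Sum using (_⊎_; inj₁; inj₂)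
open import Data.List using (length; filter)
open import Relation.Nullary using (¬_; Dec; yes; no)
open import Relation.Nullary.Decidable using (_⊎-dec_)
open import Relation.Binary.PropositionalEquality using (_≡_; _≢_)

import Data.Fin as F
open import Data.List using (allFin)

record Graph : Set where
  field
    nV   : ℕ
    nE   : ℕ
    ends : Fin nE → Fin nV × Fin nV
open Graph public

Incident : (G : Graph) → Fin (nE G) → Fin (nV G) → Set
Incident G e v = proj₁ (ends G e) ≡ v ⊎ proj₂ (ends G e) ≡ v

incident? : (G : Graph) → (v : Fin (nV G)) → (e : Fin (nE G)) → Dec (Incident G e v)
incident? G v e = (proj₁ (ends G e) ≟ v) ⊎-dec (proj₂ (ends G e) ≟ v)

ShareEnd : (G : Graph) → Fin (nE G) → Fin (nE G) → Set
ShareEnd G e f = Σ[ v ∈ Fin (nV G) ] (Incident G e v × Incident G f v)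

IsSimple : Graph → Set
IsSimple G =
  (∀ e → proj₁ (ends G e) ≢ proj₂ (ends G e)) ×
  (∀ e f → e ≢ f → ¬ (∀ v → Incident G e v → Incident G f v))

-- degree of a vertex = number of edges incident to it (loop-free setting)
degree : (G : Graph) → Fin (nV G) → ℕ
degree G v = length (filter (incident? G v) (allFin (nE G)))

IsCubic : Graph → Set
IsCubic G = ∀ v → degree G v ≡ 3

IsProperEdgeColoring : (G : Graph) (k : ℕ) → (Fin (nE G) → Fin k) → Set
IsProperEdgeColoring G k c = ∀ e f → e ≢ f → ShareEnd G e f → c e ≢ c f

EdgeColorable : Graph → ℕ → Set
EdgeColorable G k = Σ[ c ∈ (Fin (nE G) → Fin k) ] IsProperEdgeColoring G k c

-- Vertices of the result: Fin ((n + m) + 1)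
--   orig u  : original vertex u
--   sub e   : the (first) subdivision vertex on edge e
--   extra   : the second subdivision vertex on edge s
-- Edges: Fin ((m + m) + 1)
--   half₁ e : orig u — sub e        (where ends e = (u , v))
--   half₂ e : sub e — orig v        (e ≢ s)   /  sub s — extra   (e ≡ s)
--   extraE  : extra — orig v_s
module _ (H : Graph) (s : Fin (nE H)) where
  private
    n = nV H
    m = nE H

  orig : Fin n → Fin ((n + m) + 1)
  orig u = (u ↑ˡ m) ↑ˡ 1

  sub : Fin m → Fin ((n + m) + 1)
  sub e = (n ↑ʳ e) ↑ˡ 1

  extra : Fin ((n + m) + 1)
  extra = (n + m) ↑ʳ F.zero

  half₁ : Fin m → Fin ((m + m) + 1)
  half₁ e = (e ↑ˡ m) ↑ˡ 1

  half₂ : Fin m → Fin ((m + m) + 1)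
  half₂ e = (m ↑ʳ e) ↑ˡ 1

  extraE : Fin ((m + m) + 1)
  extraE = (m + m) ↑ʳ F.zero

  secondEnd : (e : Fin m) → Dec (e ≡ s) → Fin ((n + m) + 1)
  secondEnd e (yes _) = extra
  secondEnd e (no _)  = orig (proj₂ (ends H e))

  subEnds : Fin ((m + m) + 1) → Fin ((n + m) + 1) × Fin ((n + m) + 1)
  subEnds x with splitAt (m + m) x
  ... | inj₂ _ = extra , orig (proj₂ (ends H s))
  ... | inj₁ y with splitAt m y
  ...   | inj₁ e = orig (proj₁ (ends H e)) , sub e
  ...   | inj₂ e = sub e , secondEnd e (e ≟ s)

  subdivide : Graph
  subdivide = record { nV = (n + m) + 1 ; nE = (m + m) + 1 ; ends = subEnds }

  e₁ : Fin ((m + m) + 1)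
  e₁ = half₁ s

  e₂ : Fin ((m + m) + 1)
  e₂ = extraE

-- Delete the three edges e₁, middle, e₂ of the path u₀ – sub s – extra – v₀ that replaces s.
-- The remaining edges form a bipartite graph (original vertices against subdivision vertices),
-- so Kempe swaps apply to them, and the path can be recoloured freely as soon as u₀ misses
-- the colour wanted on e₁ and v₀ the colour wanted on e₂: the inner path vertices meet no other
-- edge, and k ≥ 3 leaves a colour for the middle edge.  To make e₁ and e₂ differ when they agree
-- on a, swap a with some β ≠ a from u₀; this frees β at u₀ and leaves a free at v₀, which lies on
-- the same side.  To make them agree when c e₁ = a ≠ b = c e₂, free b at u₀: if u₀ has a b-edge f,
-- its other end w is a subdivision vertex with at most one further edge, so a swap of a with a
-- third colour frees a at w without touching the colour class b, and f can then be recoloured a.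

module Submission where

open import Defs
open import Data.Nat using (ℕ; _+_; _≤_; s≤s)
open import Data.Fin using (Fin; zero; suc; _≟_; _↑ˡ_; _↑ʳ_; splitAt)
open import Data.Fin.Properties
  using (any?; ↑ˡ-injective; ↑ʳ-injective; splitAt-↑ˡ; splitAt-↑ʳ; splitAt⁻¹-↑ˡ; splitAt⁻¹-↑ʳ)
open import Data.Fin.Subset using (Subset; ⊤; _∈_; _∉_; _─_; _-_; ⁅_⁆; _⊆_; _⊂_; inside; outside)
open import Data.Fin.Subset.Properties
  using (_∈?_; ∈⊤; x∉⁅y⁆⇒x≢y; x∈p∧x≢y⇒x∈p-y; p─q⊆p; x∈p⇒p-x⊂p)
open import Data.Fin.Subset.Induction using (⊂-wellFounded)
open import Data.Vec using (_∷_; here; there)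
open import Data.Vec.Functional using (updateAt)
open import Data.Vec.Functional.Properties using (updateAt-updates; updateAt-minimal)
open import Data.Bool using (Bool; true; false; not)
open import Data.Bool.Properties using (¬-not)
open import Data.Product using (Σ-syntax; _×_; _,_; proj₁; proj₂)
open import Data.Sum using (_⊎_; inj₁; inj₂; [_,_]′)
open import Data.Empty using (⊥-elim)
open import Function using (const; _∘_)
open import Induction.WellFounded using (Acc; acc)
open import Relation.Nullary using (yes; no; ¬_)
open import Relation.Nullary.Decidable using (_×-dec_)
open import Relation.Binary.PropositionalEquality
  using (_≡_; _≢_; refl; sym; trans; cong; subst; ≢-sym; module ≡-Reasoning)

x∈p─q⇒x∉q : ∀ {n} {p q : Subset n} {x} → x ∈ p ─ q → x ∉ q
x∈p─q⇒x∉q {p = inside ∷ _} {outside ∷ _} here ()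
x∈p─q⇒x∉q {p = _ ∷ _} {_ ∷ _} (there x∈p─q) (there x∈q) = x∈p─q⇒x∉q x∈p─q x∈q

x∈p-y⇒x≢y : ∀ {n} {p : Subset n} {x y} → x ∈ p - y → x ≢ y
x∈p-y⇒x≢y x∈p-y = x∉⁅y⁆⇒x≢y (x∈p─q⇒x∉q x∈p-y)

x∈p-y⇒x∈p : ∀ {n} {p : Subset n} {x y} → x ∈ p - y → x ∈ p
x∈p-y⇒x∈p {p = p} {y = y} = p─q⊆p p ⁅ y ⁆

x∈p⇒x≡y⊎x∈p-y : ∀ {n} {p : Subset n} {x} y → x ∈ p → x ≡ y ⊎ x ∈ p - y
x∈p⇒x≡y⊎x∈p-y {x = x} y x∈p with x ≟ y
... | yes x≡y = inj₁ x≡y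
... | no x≢y = inj₂ (x∈p∧x≢y⇒x∈p-y x∈p x≢y)

pigeonhole : ∀ {A : Set} {a b x y z : A} → x ≢ y →
             x ≡ a ⊎ x ≡ b → y ≡ a ⊎ y ≡ b → z ≡ a ⊎ z ≡ b → z ≡ x ⊎ z ≡ y
pigeonhole x≢y (inj₁ refl) (inj₁ refl) _ = ⊥-elim (x≢y refl)
pigeonhole x≢y (inj₂ refl) (inj₂ refl) _ = ⊥-elim (x≢y refl)
pigeonhole _ (inj₁ refl) _ (inj₁ refl) = inj₁ refl
pigeonhole _ (inj₂ refl) _ (inj₂ refl) = inj₁ refl
pigeonhole _ (inj₁ refl) (inj₂ refl) (inj₂ refl) = inj₂ refl
pigeonhole _ (inj₂ refl) (inj₁ refl) (inj₁ refl) = inj₂ refl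

third-colour : ∀ {k} → 3 ≤ k → (x z : Fin k) → Σ[ y ∈ Fin k ] (y ≢ x × y ≢ z)
third-colour (s≤s (s≤s (s≤s _))) (suc _)          (suc _)          = zero , (λ ()) , (λ ())
third-colour (s≤s (s≤s (s≤s _))) zero             (suc zero)       = suc (suc zero) , (λ ()) , (λ ())
third-colour (s≤s (s≤s (s≤s _))) (suc zero)       zero             = suc (suc zero) , (λ ()) , (λ ())
third-colour (s≤s (s≤s (s≤s _))) zero             zero             = suc zero , (λ ()) , (λ ())
third-colour (s≤s (s≤s (s≤s _))) zero             (suc (suc _))    = suc zero , (λ ()) , (λ ())
third-colour (s≤s (s≤s (s≤s _))) (suc (suc _))    zero             = suc zero , (λ ()) , (λ ())

↑ˡ≢↑ʳ : ∀ {m n} (i : Fin m) (j : Fin n) → i ↑ˡ n ≢ m ↑ʳ j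
↑ˡ≢↑ʳ {m} {n} i j eq with trans (sym (splitAt-↑ˡ m i n)) (trans (cong (splitAt m) eq) (splitAt-↑ʳ m n j))
... | ()

incident-ends : ∀ {G e a b v} → ends G e ≡ (a , b) → Incident G e v → v ≡ a ⊎ v ≡ b
incident-ends refl (inj₁ refl) = inj₁ refl
incident-ends refl (inj₂ refl) = inj₂ refl

fst-incident : ∀ {G e a b} → ends G e ≡ (a , b) → Incident G e a
fst-incident refl = inj₁ refl

snd-incident : ∀ {G e a b} → ends G e ≡ (a , b) → Incident G e b
snd-incident refl = inj₂ refl

module EdgeColouring (G : Graph) (k : ℕ) where

  Colouring : Set
  Colouring = Fin (nE G) → Fin k

  _[_]≔_ : Colouring → Fin (nE G) → Fin k → Colouring
  c [ h ]≔ col = updateAt c h (const col)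

  recolour-at : ∀ c h col → (c [ h ]≔ col) h ≡ col
  recolour-at c h col = updateAt-updates h c

  recolour-elsewhere : ∀ c {h e} col → e ≢ h → (c [ h ]≔ col) e ≡ c e
  recolour-elsewhere c {h} {e} col e≢h = updateAt-minimal e h c e≢h

  recolour-unchanged : ∀ {A c h col e} → e ∈ A - h → (c [ h ]≔ col) e ≡ c e
  recolour-unchanged {c = c} {col = col} e∈A-h = recolour-elsewhere c col (x∈p-y⇒x≢y e∈A-h)

  ProperOn : Subset (nE G) → Colouring → Set
  ProperOn A c = ∀ {e f} → e ∈ A → f ∈ A → e ≢ f → ShareEnd G e f → c e ≢ c f

  Misses : Subset (nE G) → Colouring → Fin (nV G) → Fin k → Set
  Misses A c v col = ∀ {e} → e ∈ A → Incident G e v → c e ≢ col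

  Meets : Subset (nE G) → Colouring → Fin (nV G) → Fin k → Set
  Meets A c v col = Σ[ e ∈ Fin (nE G) ] (e ∈ A × Incident G e v × c e ≡ col)

  misses⊎meets : ∀ A c v col → Misses A c v col ⊎ Meets A c v col
  misses⊎meets A c v col with any? (λ e → (e ∈? A) ×-dec (incident? G v e ×-dec (c e ≟ col)))
  ... | yes (e , e∈A , e∙v , ce≡col) = inj₂ (e , e∈A , e∙v , ce≡col)
  ... | no ¬meets = inj₁ (λ e∈A e∙v ce≡col → ¬meets (_ , e∈A , e∙v , ce≡col))

  properOn-⊤ : ∀ {c} → ProperOn ⊤ c → IsProperEdgeColoring G k c
  properOn-⊤ proper e f = proper ∈⊤ ∈⊤

  proper⇒properOn : ∀ {A c} → IsProperEdgeColoring G k c → ProperOn A c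
  proper⇒properOn proper {e} {f} _ _ = proper e f

  misses-own-colour : ∀ {A c h v} → IsProperEdgeColoring G k c → h ∉ A → Incident G h v → Misses A c v (c h)
  misses-own-colour {h = h} proper h∉A h∙v {e} e∈A e∙v =
    proper e h (λ { refl → h∉A e∈A }) (_ , e∙v , h∙v)

  avoided⇒misses : ∀ {A v col} c → (∀ {e} → e ∈ A → ¬ Incident G e v) → Misses A c v col
  avoided⇒misses _ avoided e∈A e∙v = ⊥-elim (avoided e∈A e∙v)

  properOn-unique : ∀ {A c e f v} → ProperOn A c → e ∈ A → f ∈ A →
                    Incident G e v → Incident G f v → c e ≡ c f → e ≡ f
  properOn-unique {e = e} {f} {v} proper e∈A f∈A e∙v f∙v ce≡cf with e ≟ f
  ... | yes e≡f = e≡f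
  ... | no e≢f = ⊥-elim (proper e∈A f∈A e≢f (v , e∙v , f∙v) ce≡cf)

  properOn-⊆ : ∀ {A B c} → B ⊆ A → ProperOn A c → ProperOn B c
  properOn-⊆ B⊆A proper e∈B f∈B = proper (B⊆A e∈B) (B⊆A f∈B)

  misses-⊆ : ∀ {A B c v col} → B ⊆ A → Misses A c v col → Misses B c v col
  misses-⊆ B⊆A misses e∈B = misses (B⊆A e∈B)

  recolour-misses : ∀ {A c h col col' v} → Misses (A - h) c v col →
                    (Incident G h v → col' ≢ col) → Misses A (c [ h ]≔ col') v col
  recolour-misses {A} {c} {h} {col} {col'} misses h∙v⇒col'≢col {e} e∈A e∙v
    with x∈p⇒x≡y⊎x∈p-y h e∈A
  ... | inj₁ refl = subst (_≢ col) (sym (recolour-at c h col')) (h∙v⇒col'≢col e∙v)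
  ... | inj₂ e∈A-h = subst (_≢ col) (sym (recolour-unchanged e∈A-h)) (misses e∈A-h e∙v)

  recolour-proper : ∀ {A c h col} → ProperOn (A - h) c →
                    (∀ {v} → Incident G h v → Misses (A - h) c v col) → ProperOn A (c [ h ]≔ col)
  recolour-proper {A} {c} {h} {col} proper ends-miss {e} {f} e∈A f∈A e≢f (v , e∙v , f∙v)
    with x∈p⇒x≡y⊎x∈p-y h e∈A | x∈p⇒x≡y⊎x∈p-y h f∈A
  ... | inj₁ refl | inj₁ refl = ⊥-elim (e≢f refl)
  ... | inj₁ refl | inj₂ f∈A-h = λ eq →
    ends-miss e∙v f∈A-h f∙v (trans (sym (recolour-unchanged f∈A-h)) (trans (sym eq) (recolour-at c h col)))
  ... | inj₂ e∈A-h | inj₁ refl = λ eq →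
    ends-miss f∙v e∈A-h e∙v (trans (sym (recolour-unchanged e∈A-h)) (trans eq (recolour-at c h col)))
  ... | inj₂ e∈A-h | inj₂ f∈A-h = λ eq →
    proper e∈A-h f∈A-h e≢f (v , e∙v , f∙v) (trans (sym (recolour-unchanged e∈A-h)) (trans eq (recolour-unchanged f∈A-h)))

  module KempeChains (side : Fin (nV G) → Bool) where

    Bipartite : Subset (nE G) → Set
    Bipartite A = ∀ {e} → e ∈ A → side (proj₁ (ends G e)) ≢ side (proj₂ (ends G e))

    record OtherEnd (e : Fin (nE G)) (v : Fin (nV G)) : Set where
      field
        vertex   : Fin (nV G)
        incident : Incident G e vertex
        sides≢   : side vertex ≢ side v
        only     : ∀ {t} → Incident G e t → t ≡ v ⊎ t ≡ vertex

    otherEnd : ∀ {e v} → side (proj₁ (ends G e)) ≢ side (proj₂ (ends G e)) → Incident G e v → OtherEnd e v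
    otherEnd sides≢ (inj₁ refl) = record
      { vertex = _ ; incident = inj₂ refl ; sides≢ = ≢-sym sides≢
      ; only = λ { (inj₁ refl) → inj₁ refl ; (inj₂ refl) → inj₂ refl } }
    otherEnd sides≢ (inj₂ refl) = record
      { vertex = _ ; incident = inj₁ refl ; sides≢ = sides≢
      ; only = λ { (inj₁ refl) → inj₂ refl ; (inj₂ refl) → inj₁ refl } }

    -- What interchanging p and q along the (p,q)-chain starting at w achieves.
    record KempeSwap (A : Subset (nE G)) (c : Colouring) (p q : Fin k) (w : Fin (nV G)) : Set where
      field
        colouring : Colouring
        proper    : ProperOn A colouring
        misses-p  : Misses A colouring w p
        untouched : ∀ {v} → Misses A c v p → Misses A c v q →
                    Misses A colouring v p × Misses A colouring v q
        across    : ∀ {v} → side v ≢ side w → Misses A c v p → Misses A colouring v p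
        along     : ∀ {v} → side v ≡ side w → v ≢ w → Misses A c v q → Misses A colouring v q
        only-p-q  : ∀ {e col} → col ≢ p → col ≢ q → colouring e ≡ col → c e ≡ col

    kempeSwap-trivial : ∀ {A c p q w} → ProperOn A c → Misses A c w p → KempeSwap A c p q w
    kempeSwap-trivial {c = c} proper w-p = record
      { colouring = c ; proper = proper ; misses-p = w-p ; untouched = _,_
      ; across = λ _ v-p → v-p ; along = λ _ _ v-q → v-q ; only-p-q = λ _ _ ce≡col → ce≡col }

    -- With h the p-edge at w and x its other end, swap q and p from x in A − h, then give h colour q.
    kempeSwap-acc : ∀ {A c p q w} → Acc _⊂_ A → Bipartite A → ProperOn A c → p ≢ q →
                    Misses A c w q → KempeSwap A c p q w
    kempeSwap-acc {A} {c} {p} {q} {w} _ _ proper _ w-q with misses⊎meets A c w p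
    ... | inj₁ w-p = kempeSwap-trivial proper w-p
    kempeSwap-acc {A} {c} {p} {q} {w} (acc rec) bipartite proper p≢q w-q
      | inj₂ (h , h∈A , h∙w , ch≡p) = record
      { colouring = c'
      ; proper    = recolour-proper R.proper ends-miss-q
      ; misses-p  = recolour-misses (proj₂ (R.untouched (restrict w-q) w-p')) (λ _ → ≢-sym p≢q)
      ; untouched = untouched
      ; across    = across
      ; along     = along
      ; only-p-q  = only-p-q
      }
      where
      open OtherEnd (otherEnd (bipartite h∈A) h∙w) renaming (vertex to x; incident to h∙x)
      A' = A - h

      restrict : ∀ {c v col} → Misses A c v col → Misses A' c v col
      restrict = misses-⊆ x∈p-y⇒x∈p

      p-edge-unique : ∀ {v} → Incident G h v → Misses A' c v p
      p-edge-unique h∙v e∈A' e∙v ce≡p =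
        x∈p-y⇒x≢y e∈A' (properOn-unique proper (x∈p-y⇒x∈p e∈A') h∈A e∙v h∙v (trans ce≡p (sym ch≡p)))

      w-p' : Misses A' c w p
      w-p' = p-edge-unique h∙w

      R : KempeSwap A' c q p x
      R = kempeSwap-acc (rec (x∈p⇒p-x⊂p h∈A)) (λ e∈A' → bipartite (x∈p-y⇒x∈p e∈A'))
            (properOn-⊆ x∈p-y⇒x∈p proper) (≢-sym p≢q) (p-edge-unique h∙x)
      module R = KempeSwap R

      c' : Colouring
      c' = R.colouring [ h ]≔ q

      ends-miss-q : ∀ {v} → Incident G h v → Misses A' R.colouring v q
      ends-miss-q h∙v with only h∙v
      ... | inj₁ refl = R.across (≢-sym sides≢) (restrict w-q)
      ... | inj₂ refl = R.misses-p

      p-missing⇒avoids-h : ∀ {v} → Misses A c v p → ¬ Incident G h v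
      p-missing⇒avoids-h v-p h∙v = v-p h∈A h∙v ch≡p

      untouched : ∀ {v} → Misses A c v p → Misses A c v q → Misses A c' v p × Misses A c' v q
      untouched v-p v-q with R.untouched (restrict v-q) (restrict v-p)
      ... | v-q' , v-p' = recolour-misses v-p' (⊥-elim ∘ p-missing⇒avoids-h v-p)
                        , recolour-misses v-q' (⊥-elim ∘ p-missing⇒avoids-h v-p)

      across : ∀ {v} → side v ≢ side w → Misses A c v p → Misses A c' v p
      across {v} sv≢sw v-p = recolour-misses (R.along (trans (¬-not sv≢sw) (sym (¬-not sides≢))) v≢x (restrict v-p))
                             (λ _ → ≢-sym p≢q)
        where
        v≢x : v ≢ x
        v≢x refl = p-missing⇒avoids-h v-p h∙x

      along : ∀ {v} → side v ≡ side w → v ≢ w → Misses A c v q → Misses A c' v q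
      along {v} sv≡sw v≢w v-q =
        recolour-misses (R.across (λ sv≡sx → sides≢ (trans (sym sv≡sx) sv≡sw)) (restrict v-q)) h∙v-absurd
        where
        h∙v-absurd : Incident G h v → q ≢ q
        h∙v-absurd h∙v with only h∙v
        ... | inj₁ v≡w = ⊥-elim (v≢w v≡w)
        ... | inj₂ refl = ⊥-elim (sides≢ sv≡sw)

      only-p-q : ∀ {e col} → col ≢ p → col ≢ q → c' e ≡ col → c e ≡ col
      only-p-q {e} col≢p col≢q c'e≡col with e ≟ h
      ... | yes refl = ⊥-elim (col≢q (trans (sym c'e≡col) (recolour-at R.colouring h q)))
      ... | no e≢h = R.only-p-q col≢q col≢p (trans (sym (recolour-elsewhere R.colouring q e≢h)) c'e≡col)

    kempeSwap : ∀ {A c p q w} → Bipartite A → ProperOn A c → p ≢ q → Misses A c w q → KempeSwap A c p q w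
    kempeSwap {A} = kempeSwap-acc (⊂-wellFounded A)

module Subdivision (H : Graph) (s : Fin (nE H)) where
  private
    n = nV H
    m = nE H

  G : Graph
  G = subdivide H s

  u₀ v₀ : Fin (nV G)
  u₀ = orig H s (proj₁ (ends H s))
  v₀ = orig H s (proj₂ (ends H s))

  middle : Fin (nE G)
  middle = half₂ H s s

  isOriginal : Fin (nV G) → Bool
  isOriginal v = [ (λ y → [ const true , const false ]′ (splitAt n y)) , const false ]′ (splitAt (n + m) v)

  isOriginal-orig : ∀ u → isOriginal (orig H s u) ≡ true
  isOriginal-orig u rewrite splitAt-↑ˡ (n + m) (u ↑ˡ m) 1 | splitAt-↑ˡ n u m = refl

  isOriginal-sub : ∀ e → isOriginal (sub H s e) ≡ false
  isOriginal-sub e rewrite splitAt-↑ˡ (n + m) (n ↑ʳ e) 1 | splitAt-↑ʳ n m e = refl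

  isOriginal-extra : isOriginal (extra H s) ≡ false
  isOriginal-extra rewrite splitAt-↑ʳ (n + m) 1 zero = refl

  orig-injective : ∀ {u u'} → orig H s u ≡ orig H s u' → u ≡ u'
  orig-injective {u} {u'} = ↑ˡ-injective m u u' ∘ ↑ˡ-injective 1 (u ↑ˡ m) (u' ↑ˡ m)

  sub-injective : ∀ {e e'} → sub H s e ≡ sub H s e' → e ≡ e'
  sub-injective {e} {e'} = ↑ʳ-injective n e e' ∘ ↑ˡ-injective 1 (n ↑ʳ e) (n ↑ʳ e')

  orig≢sub : ∀ {u e} → orig H s u ≢ sub H s e
  orig≢sub {u} {e} = ↑ˡ≢↑ʳ u e ∘ ↑ˡ-injective 1 (u ↑ˡ m) (n ↑ʳ e)

  orig≢extra : ∀ {u} → orig H s u ≢ extra H s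
  orig≢extra {u} = ↑ˡ≢↑ʳ (u ↑ˡ m) zero

  sub≢extra : ∀ {e} → sub H s e ≢ extra H s
  sub≢extra {e} = ↑ˡ≢↑ʳ (n ↑ʳ e) zero

  data SubdividedEdge : Fin (nE G) → Set where
    first  : ∀ e → SubdividedEdge (half₁ H s e)
    second : ∀ e → SubdividedEdge (half₂ H s e)
    last   : SubdividedEdge (extraE H s)

  subdividedEdge : ∀ x → SubdividedEdge x
  subdividedEdge x with splitAt (m + m) x in x≡
  ... | inj₂ zero = subst SubdividedEdge (splitAt⁻¹-↑ʳ x≡) last
  ... | inj₁ y with splitAt m y in y≡
  ...   | inj₁ e = subst SubdividedEdge (trans (cong (_↑ˡ 1) (splitAt⁻¹-↑ˡ y≡)) (splitAt⁻¹-↑ˡ x≡)) (first e)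
  ...   | inj₂ e = subst SubdividedEdge (trans (cong (_↑ˡ 1) (splitAt⁻¹-↑ʳ y≡)) (splitAt⁻¹-↑ˡ x≡)) (second e)

  ends-half₁ : ∀ e → ends G (half₁ H s e) ≡ (orig H s (proj₁ (ends H e)) , sub H s e)
  ends-half₁ e rewrite splitAt-↑ˡ (m + m) (e ↑ˡ m) 1 | splitAt-↑ˡ m e m = refl

  ends-half₂ : ∀ e → ends G (half₂ H s e) ≡ (sub H s e , secondEnd H s e (e ≟ s))
  ends-half₂ e rewrite splitAt-↑ˡ (m + m) (m ↑ʳ e) 1 | splitAt-↑ʳ m m e = refl

  ends-other-half₂ : ∀ {e} → e ≢ s → ends G (half₂ H s e) ≡ (sub H s e , orig H s (proj₂ (ends H e)))
  ends-other-half₂ {e} e≢s with e ≟ s | ends-half₂ e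
  ... | yes e≡s | _ = ⊥-elim (e≢s e≡s)
  ... | no _ | eq = eq

  ends-middle : ends G middle ≡ (sub H s s , extra H s)
  ends-middle with s ≟ s | ends-half₂ s
  ... | yes _ | eq = eq
  ... | no s≢s | _ = ⊥-elim (s≢s refl)

  ends-e₂ : ends G (e₂ H s) ≡ (extra H s , v₀)
  ends-e₂ rewrite splitAt-↑ʳ (m + m) 1 zero = refl

  e₁≢middle : e₁ H s ≢ middle
  e₁≢middle = ↑ˡ≢↑ʳ s s ∘ ↑ˡ-injective 1 (s ↑ˡ m) (m ↑ʳ s)

  e₁≢e₂ : e₁ H s ≢ e₂ H s
  e₁≢e₂ = ↑ˡ≢↑ʳ (s ↑ˡ m) zero

  active : Subset (nE G)
  active = ⊤ - e₂ H s - middle - e₁ H s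

  active⇒≢e₁ : ∀ {x} → x ∈ active → x ≢ e₁ H s
  active⇒≢e₁ = x∈p-y⇒x≢y

  active⇒≢middle : ∀ {x} → x ∈ active → x ≢ middle
  active⇒≢middle = x∈p-y⇒x≢y ∘ x∈p-y⇒x∈p

  active⇒≢e₂ : ∀ {x} → x ∈ active → x ≢ e₂ H s
  active⇒≢e₂ = x∈p-y⇒x≢y ∘ x∈p-y⇒x∈p ∘ x∈p-y⇒x∈p

  e₁∉active : e₁ H s ∉ active
  e₁∉active e₁∈A = active⇒≢e₁ e₁∈A refl

  e₂∉active : e₂ H s ∉ active
  e₂∉active e₂∈A = active⇒≢e₂ e₂∈A refl

  e₁∙u₀ : Incident G (e₁ H s) u₀
  e₁∙u₀ = fst-incident {G = G} (ends-half₁ s)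

  e₂∙v₀ : Incident G (e₂ H s) v₀
  e₂∙v₀ = snd-incident {G = G} ends-e₂

  data ActiveEdge : Fin (nE G) → Set where
    first  : ∀ {e} → e ≢ s → ActiveEdge (half₁ H s e)
    second : ∀ {e} → e ≢ s → ActiveEdge (half₂ H s e)

  activeEdge : ∀ {x} → x ∈ active → ActiveEdge x
  activeEdge {x} x∈A = view (subdividedEdge x) x∈A
    where
    view : ∀ {x} → SubdividedEdge x → x ∈ active → ActiveEdge x
    view (first e) x∈A = first λ { refl → active⇒≢e₁ x∈A refl }
    view (second e) x∈A = second λ { refl → active⇒≢middle x∈A refl }
    view last x∈A = ⊥-elim (active⇒≢e₂ x∈A refl)

  active-bipartite : ∀ {x} → x ∈ active → isOriginal (proj₁ (ends G x)) ≢ isOriginal (proj₂ (ends G x))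
  active-bipartite x∈A with activeEdge x∈A
  ... | first {e} _
    rewrite ends-half₁ e | isOriginal-orig (proj₁ (ends H e)) | isOriginal-sub e = λ ()
  ... | second {e} e≢s
    rewrite ends-other-half₂ e≢s | isOriginal-orig (proj₂ (ends H e)) | isOriginal-sub e = λ ()

  active-incident : ∀ {x v} → x ∈ active → Incident G x v →
    Σ[ e ∈ Fin m ] (e ≢ s × (x ≡ half₁ H s e ⊎ x ≡ half₂ H s e) × (v ≡ sub H s e ⊎ isOriginal v ≡ true))
  active-incident x∈A x∙v with activeEdge x∈A
  ... | first {e} e≢s =
    e , e≢s , inj₁ refl , [ (λ { refl → inj₂ (isOriginal-orig _) }) , inj₁ ]′ (incident-ends {G = G} (ends-half₁ e) x∙v)
  ... | second {e} e≢s =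
    e , e≢s , inj₂ refl , [ inj₁ , (λ { refl → inj₂ (isOriginal-orig _) }) ]′ (incident-ends {G = G} (ends-other-half₂ e≢s) x∙v)

  active-avoids-sub-s : ∀ {x} → x ∈ active → ¬ Incident G x (sub H s s)
  active-avoids-sub-s x∈A x∙sub with active-incident x∈A x∙sub
  ... | e , e≢s , _ , inj₁ sub≡ = e≢s (sym (sub-injective sub≡))
  ... | _ , _ , _ , inj₂ isOrig with trans (sym (isOriginal-sub s)) isOrig
  ...   | ()

  active-avoids-extra : ∀ {x} → x ∈ active → ¬ Incident G x (extra H s)
  active-avoids-extra x∈A x∙extra with active-incident x∈A x∙extra
  ... | _ , _ , _ , inj₁ extra≡ = sub≢extra (sym extra≡)
  ... | _ , _ , _ , inj₂ isOrig with trans (sym isOriginal-extra) isOrig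
  ...   | ()

  active-at-sub : ∀ {x v} → x ∈ active → Incident G x v → isOriginal v ≡ false →
    Σ[ e ∈ Fin m ] (v ≡ sub H s e × (x ≡ half₁ H s e ⊎ x ≡ half₂ H s e))
  active-at-sub x∈A x∙v notOrig with active-incident x∈A x∙v
  ... | e , _ , halves , inj₁ v≡sub = e , v≡sub , halves
  ... | _ , _ , _ , inj₂ isOrig with trans (sym notOrig) isOrig
  ...   | ()

  active-at-sub-at-most-two : ∀ {f h g v} → f ∈ active → h ∈ active → g ∈ active →
    Incident G f v → Incident G h v → Incident G g v → isOriginal v ≡ false → f ≢ h → g ≡ f ⊎ g ≡ h
  active-at-sub-at-most-two f∈A h∈A g∈A f∙v h∙v g∙v notOrig f≢h
    with active-at-sub f∈A f∙v notOrig | active-at-sub h∈A h∙v notOrig | active-at-sub g∈A g∙v notOrig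
  ... | e , v≡ , f-half | e' , v≡' , h-half | e'' , v≡'' , g-half
    with sub-injective (trans (sym v≡) v≡') | sub-injective (trans (sym v≡) v≡'')
  ... | refl | refl = pigeonhole f≢h f-half h-half g-half

  e₁-avoids-extra : ¬ Incident G (e₁ H s) (extra H s)
  e₁-avoids-extra e₁∙extra with incident-ends {G = G} (ends-half₁ s) e₁∙extra
  ... | inj₁ extra≡u₀ = orig≢extra (sym extra≡u₀)
  ... | inj₂ extra≡sub = sub≢extra (sym extra≡sub)

  e₁-avoids-v₀ : u₀ ≢ v₀ → ¬ Incident G (e₁ H s) v₀
  e₁-avoids-v₀ u₀≢v₀ e₁∙v₀ with incident-ends {G = G} (ends-half₁ s) e₁∙v₀
  ... | inj₁ v₀≡u₀ = u₀≢v₀ (sym v₀≡u₀)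
  ... | inj₂ v₀≡sub = orig≢sub v₀≡sub

  middle-avoids-v₀ : ¬ Incident G middle v₀
  middle-avoids-v₀ middle∙v₀ with incident-ends {G = G} ends-middle middle∙v₀
  ... | inj₁ v₀≡sub = orig≢sub v₀≡sub
  ... | inj₂ v₀≡extra = orig≢extra v₀≡extra

  module Colourings {k : ℕ} where
    open EdgeColouring G k
    open KempeChains isOriginal

    extend-along-path : ∀ {c x z} → 3 ≤ k → u₀ ≢ v₀ → ProperOn active c →
      Misses active c u₀ x → Misses active c v₀ z →
      Σ[ c' ∈ Colouring ] (IsProperEdgeColoring G k c' × c' (e₁ H s) ≡ x × c' (e₂ H s) ≡ z)
    extend-along-path {c} {x} {z} 3≤k u₀≢v₀ proper u₀-x v₀-z =
      c₃ , properOn-⊤ proper₃ , c₃-e₁ , recolour-at c₂ (e₂ H s) z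
      where
      y : Fin k
      y = proj₁ (third-colour 3≤k x z)
      y≢x : y ≢ x
      y≢x = proj₁ (proj₂ (third-colour 3≤k x z))
      y≢z : y ≢ z
      y≢z = proj₂ (proj₂ (third-colour 3≤k x z))

      c₁ c₂ c₃ : Colouring
      c₁ = c [ e₁ H s ]≔ x
      c₂ = c₁ [ middle ]≔ y
      c₃ = c₂ [ e₂ H s ]≔ z

      proper₁ : ProperOn (⊤ - e₂ H s - middle) c₁
      proper₁ = recolour-proper proper λ e₁∙v → case (incident-ends {G = G} (ends-half₁ s) e₁∙v)
        where
        case : ∀ {v} → v ≡ u₀ ⊎ v ≡ sub H s s → Misses active c v x
        case (inj₁ refl) = u₀-x
        case (inj₂ refl) = avoided⇒misses c active-avoids-sub-s

      proper₂ : ProperOn (⊤ - e₂ H s) c₂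
      proper₂ = recolour-proper proper₁ λ middle∙v → case (incident-ends {G = G} ends-middle middle∙v)
        where
        case : ∀ {v} → v ≡ sub H s s ⊎ v ≡ extra H s → Misses (⊤ - e₂ H s - middle) c₁ v y
        case (inj₁ refl) = recolour-misses (avoided⇒misses c active-avoids-sub-s) (λ _ → ≢-sym y≢x)
        case (inj₂ refl) = recolour-misses (avoided⇒misses c active-avoids-extra) (⊥-elim ∘ e₁-avoids-extra)

      proper₃ : ProperOn ⊤ c₃
      proper₃ = recolour-proper proper₂ λ e₂∙v → case (incident-ends {G = G} ends-e₂ e₂∙v)
        where
        case : ∀ {v} → v ≡ extra H s ⊎ v ≡ v₀ → Misses (⊤ - e₂ H s) c₂ v z
        case (inj₁ refl) = recolour-misses (recolour-misses (avoided⇒misses c active-avoids-extra)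
                                              (⊥-elim ∘ e₁-avoids-extra)) (λ _ → y≢z)
        case (inj₂ refl) = recolour-misses (recolour-misses v₀-z (⊥-elim ∘ e₁-avoids-v₀ u₀≢v₀))
                                            (⊥-elim ∘ middle-avoids-v₀)

      c₃-e₁ : c₃ (e₁ H s) ≡ x
      c₃-e₁ = begin
        c₃ (e₁ H s) ≡⟨ recolour-elsewhere c₂ z e₁≢e₂ ⟩
        c₂ (e₁ H s) ≡⟨ recolour-elsewhere c₁ y e₁≢middle ⟩
        c₁ (e₁ H s) ≡⟨ recolour-at c (e₁ H s) x ⟩
        x           ∎
        where open ≡-Reasoning

    -- Besides f, w meets at most one active edge, so some γ ∉ {a, b} is free at w and an
    -- (a,γ)-swap from w frees a there without touching the colour class b.
    free-colour-at-sub : ∀ {c a b f w} → 3 ≤ k → ProperOn active c → a ≢ b →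
      f ∈ active → Incident G f w → isOriginal w ≡ false → c f ≡ b →
      Σ[ γ ∈ Fin k ] (γ ≢ b × KempeSwap active c a γ w)
    free-colour-at-sub {c} {a} {b} {f} {w} 3≤k proper a≢b f∈A f∙w w-sub cf≡b
      with misses⊎meets active c w a
    ... | inj₁ w-a = a , a≢b , kempeSwap-trivial proper w-a
    ... | inj₂ (h , h∈A , h∙w , ch≡a) with third-colour 3≤k a b
    ...   | γ , γ≢a , γ≢b = γ , γ≢b , kempeSwap active-bipartite proper (≢-sym γ≢a) w-γ
      where
      w-γ : Misses active c w γ
      w-γ g∈A g∙w cg≡γ with active-at-sub-at-most-two f∈A h∈A g∈A f∙w h∙w g∙w w-sub
                              (λ { refl → a≢b (trans (sym ch≡a) cf≡b) })
      ... | inj₁ refl = γ≢b (trans (sym cg≡γ) cf≡b)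
      ... | inj₂ refl = γ≢a (trans (sym cg≡γ) ch≡a)

    colouring-with-e₁≢e₂ : ∀ {c} → 3 ≤ k → u₀ ≢ v₀ → IsProperEdgeColoring G k c →
      Σ[ c' ∈ Colouring ] (IsProperEdgeColoring G k c' × c' (e₁ H s) ≢ c' (e₂ H s))
    colouring-with-e₁≢e₂ {c} 3≤k u₀≢v₀ proper with c (e₁ H s) ≟ c (e₂ H s)
    ... | no a≢b = c , proper , a≢b
    ... | yes a≡b with third-colour 3≤k (c (e₁ H s)) (c (e₁ H s))
    ...   | β , β≢a , _ =
      let c' , proper' , c'e₁≡β , c'e₂≡a = extend-along-path 3≤k u₀≢v₀ R.proper R.misses-p v₀-a
      in c' , proper' , λ c'e₁≡c'e₂ → β≢a (trans (sym c'e₁≡β) (trans c'e₁≡c'e₂ c'e₂≡a))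
      where
      R : KempeSwap active c β (c (e₁ H s)) u₀
      R = kempeSwap active-bipartite (proper⇒properOn proper) β≢a
            (misses-own-colour proper e₁∉active e₁∙u₀)
      module R = KempeSwap R
      v₀-a : Misses active R.colouring v₀ (c (e₁ H s))
      v₀-a = R.along (trans (isOriginal-orig _) (sym (isOriginal-orig _))) (u₀≢v₀ ∘ sym)
               (subst (Misses active c v₀) (sym a≡b)
                 (misses-own-colour proper e₂∉active e₂∙v₀))

    extend-with-e₁≡e₂ : ∀ {c b} → 3 ≤ k → u₀ ≢ v₀ → ProperOn active c →
      Misses active c u₀ b → Misses active c v₀ b →
      Σ[ c' ∈ Colouring ] (IsProperEdgeColoring G k c' × c' (e₁ H s) ≡ c' (e₂ H s))
    extend-with-e₁≡e₂ 3≤k u₀≢v₀ proper u₀-b v₀-b =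
      let c' , proper' , c'e₁≡b , c'e₂≡b = extend-along-path 3≤k u₀≢v₀ proper u₀-b v₀-b
      in c' , proper' , trans c'e₁≡b (sym c'e₂≡b)

    free-e₂-colour-at-u₀ : ∀ {c f} → 3 ≤ k → IsProperEdgeColoring G k c → c (e₁ H s) ≢ c (e₂ H s) →
      f ∈ active → Incident G f u₀ → c f ≡ c (e₂ H s) →
      Σ[ c' ∈ Colouring ] (ProperOn active c' × Misses active c' u₀ (c (e₂ H s)) × Misses active c' v₀ (c (e₂ H s)))
    free-e₂-colour-at-u₀ {c} {f} 3≤k proper a≢b f∈A f∙u₀ cf≡b =
      let γ , γ≢b , R = free-colour-at-sub 3≤k properA a≢b f∈A f∙w w-sub cf≡b
      in recolour-f γ≢b R
      where
      a b : Fin k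
      a = c (e₁ H s)
      b = c (e₂ H s)

      properA : ProperOn active c
      properA = proper⇒properOn proper

      open OtherEnd (otherEnd (active-bipartite f∈A) f∙u₀) renaming (vertex to w; incident to f∙w)

      w-sub : isOriginal w ≡ false
      w-sub = trans (¬-not sides≢) (cong not (isOriginal-orig _))

      recolour-f : ∀ {γ} → γ ≢ b → KempeSwap active c a γ w →
        Σ[ c' ∈ Colouring ] (ProperOn active c' × Misses active c' u₀ b × Misses active c' v₀ b)
      recolour-f γ≢b R = R.colouring [ f ]≔ a , proper' , u₀-b , v₀-b
        where
        module R = KempeSwap R

        keeps-b : ∀ {e} → R.colouring e ≡ b → c e ≡ b
        keeps-b = R.only-p-q (≢-sym a≢b) (≢-sym γ≢b)

        ends-miss-a : ∀ {v} → v ≡ u₀ ⊎ v ≡ w → Misses (active - f) R.colouring v a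
        ends-miss-a (inj₁ refl) = misses-⊆ x∈p-y⇒x∈p (R.across (≢-sym sides≢) (misses-own-colour proper e₁∉active e₁∙u₀))
        ends-miss-a (inj₂ refl) = misses-⊆ x∈p-y⇒x∈p R.misses-p

        proper' : ProperOn active (R.colouring [ f ]≔ a)
        proper' = recolour-proper (properOn-⊆ x∈p-y⇒x∈p R.proper) (ends-miss-a ∘ only)

        u₀-b : Misses active (R.colouring [ f ]≔ a) u₀ b
        u₀-b = recolour-misses (λ g∈A' g∙u₀ cg≡b → x∈p-y⇒x≢y g∈A'
                 (properOn-unique properA (x∈p-y⇒x∈p g∈A') f∈A g∙u₀ f∙u₀ (trans (keeps-b cg≡b) (sym cf≡b))))
                 (λ _ → a≢b)

        v₀-b : Misses active (R.colouring [ f ]≔ a) v₀ b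
        v₀-b = recolour-misses (λ g∈A' g∙v₀ cg≡b →
                 misses-own-colour proper e₂∉active e₂∙v₀ (x∈p-y⇒x∈p g∈A') g∙v₀ (keeps-b cg≡b))
                 (λ _ → a≢b)

    colouring-with-e₁≡e₂ : ∀ {c} → 3 ≤ k → u₀ ≢ v₀ → IsProperEdgeColoring G k c →
      Σ[ c' ∈ Colouring ] (IsProperEdgeColoring G k c' × c' (e₁ H s) ≡ c' (e₂ H s))
    colouring-with-e₁≡e₂ {c} 3≤k u₀≢v₀ proper with c (e₁ H s) ≟ c (e₂ H s)
    ... | yes a≡b = c , proper , a≡b
    ... | no a≢b with misses⊎meets active c u₀ (c (e₂ H s))
    ...   | inj₁ u₀-b = extend-with-e₁≡e₂ 3≤k u₀≢v₀ (proper⇒properOn proper) u₀-b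
                          (misses-own-colour proper e₂∉active e₂∙v₀)
    ...   | inj₂ (f , f∈A , f∙u₀ , cf≡b) =
      let c' , proper' , u₀-b , v₀-b = free-e₂-colour-at-u₀ 3≤k proper a≢b f∈A f∙u₀ cf≡b
      in extend-with-e₁≡e₂ 3≤k u₀≢v₀ proper' u₀-b v₀-b

lemma2p10 : (H : Graph) → IsSimple H → IsCubic H → (s : Fin (nE H)) →
    (k : ℕ) → 3 ≤ k → EdgeColorable (subdivide H s) k →
    (Σ[ c₁ ∈ (Fin (nE (subdivide H s)) → Fin k) ]
       (IsProperEdgeColoring (subdivide H s) k c₁ × c₁ (e₁ H s) ≡ c₁ (e₂ H s)))
    × (Σ[ c₂ ∈ (Fin (nE (subdivide H s)) → Fin k) ]
       (IsProperEdgeColoring (subdivide H s) k c₂ × c₂ (e₁ H s) ≢ c₂ (e₂ H s)))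
lemma2p10 H (loopless , _) _ s k 3≤k (c , proper) =
  colouring-with-e₁≡e₂ 3≤k u₀≢v₀ proper , colouring-with-e₁≢e₂ 3≤k u₀≢v₀ proper
  where
  open Subdivision H s
  open Colourings {k}

  u₀≢v₀ : u₀ ≢ v₀
  u₀≢v₀ = loopless s ∘ orig-injective
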